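{- Let $G$ be a graph and $X,Y,Z\subseteq V(G)$. If for every $z\in Z$ there is an $X$--$Y$ separation of $G$ of minimal order (among all $X$--$Y$ separations of $G$) with $z$ in its separator, then there is a nested set $\mathcal{S}$ of $X$--$Y$ separations of $G$ of minimal order such that the union of their separators contains $Z$.
   Context: A separation of a graph $G$ is an ordered pair $(A,B)$ of sets $A,B\subseteq V(G)$ with $G[A]\cup G[B]=G$; its separator is $A\cap B$ and its order is $|A\cap B|$. For $X,Y\subseteq V(G)$, an $X$--$Y$ separation is a separation $(A,B)$ with $X\subseteq A$ and $Y\subseteq B$. Two separations $(A,B)$ and $(A',B')$ are nested if either ($A\subseteq A'$ and $B\supseteq B'$) or ($A\supseteq A'$ and $B\subseteq B'$). A set of separations is nested if its elements are pairwise nested. -}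

module Defs where

open import Data.Nat using (ℕ; _≤_)
open import Data.Fin using (Fin)
open import Data.Fin.Subset using (Subset; _∈_; _⊆_; _∩_; ∣_∣)
open import Data.Product using (_×_; Σ; ∃-syntax; _,_)
open import Data.Sum using (_⊎_)
open import Data.List using (List)
open import Data.List.Membership.Propositional renaming (_∈_ to _∈ₗ_)
open import Relation.Nullary using (¬_)
open import Relation.Binary.PropositionalEquality using (_≡_)

record Graph (n : ℕ) : Set₁ where
  field
    Adj   : Fin n → Fin n → Set
    sym   : ∀ {u v} → Adj u v → Adj v u
    irrefl : ∀ {v} → ¬ Adj v v
open Graph public

Sep : ℕ → Set
Sep n = Subset n × Subset n

IsSeparation : ∀ {n} → Graph n → Sep n → Set
IsSeparation {n} G (A , B) =
  (∀ (v : Fin n) → v ∈ A ⊎ v ∈ B) ×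
  (∀ (u v : Fin n) → Adj G u v → (u ∈ A × v ∈ A) ⊎ (u ∈ B × v ∈ B))

separator : ∀ {n} → Sep n → Subset n
separator (A , B) = A ∩ B

order : ∀ {n} → Sep n → ℕ
order s = ∣ separator s ∣

IsXYSep : ∀ {n} → Graph n → Subset n → Subset n → Sep n → Set
IsXYSep G X Y (A , B) = IsSeparation G (A , B) × X ⊆ A × Y ⊆ B

IsMinXYSep : ∀ {n} → Graph n → Subset n → Subset n → Sep n → Set
IsMinXYSep {n} G X Y s =
  IsXYSep G X Y s × (∀ (t : Sep n) → IsXYSep G X Y t → order s ≤ order t)

Nested : ∀ {n} → Sep n → Sep n → Set
Nested (A , B) (A' , B') = (A ⊆ A' × B' ⊆ B) ⊎ (A' ⊆ A × B ⊆ B')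

NestedSet : ∀ {n} → List (Sep n) → Set
NestedSet 𝒮 = ∀ {s t} → s ∈ₗ 𝒮 → t ∈ₗ 𝒮 → Nested s t

SeparatorsCover : ∀ {n} → List (Sep n) → Subset n → Set
SeparatorsCover 𝒮 Z = ∀ {z} → z ∈ Z → ∃[ s ] (s ∈ₗ 𝒮 × z ∈ separator s)

-- Choose for every z ∈ Z a minimal X–Y separation s_z with z in its separator.
-- Separations form a distributive lattice under (A , B) ∧ (C , D) = (A ∩ C , B ∪ D)
-- and (A , B) ∨ (C , D) = (A ∪ C , B ∩ D), on which the order is submodular;
-- hence the minimal X–Y separations form a sublattice. Its elementary symmetric
-- polynomials e₁ ≥ e₂ ≥ … ≥ eₖ in the s_z are therefore a chain of minimal X–Y
-- separations, and a vertex in the separator of some s_z lies in the separator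
-- of some eₘ: take m − 1 to be the last index at which the vertex is still on
-- the A-side of the chain.
module Submission where

open import Defs hiding (sym)
open import Data.Nat using (ℕ; zero; suc; _≤_; _<_; _≤′_; ≤′-refl; ≤′-step; z≤n; s≤s; _+_)
open import Data.Nat.Properties
  using (≤-refl; ≤-total; ≤⇒≤′; m≤n⇒m≤1+n; m<n⇒m<1+n; m≤n⇒m<n∨m≡n; +-suc; +-mono-≤;
         +-cancelˡ-≤; +-cancelʳ-≤; +-monoˡ-≤; +-monoʳ-≤; ≤-trans; module ≤-Reasoning)
open import Data.Fin.Subset using (Subset; outside; inside; _∈_; _⊆_; _∩_; _∪_; ⊤; ⊥; ∣_∣)
open import Data.Fin.Subset.Properties
  using (x∈p∩q⁺; x∈p∩q⁻; x∈p∪q⁺; x∈p∪q⁻; p⊆q⇒∣p∣≤∣q∣; ∩-identityˡ; ∩-zeroˡ;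
         ∪-identityˡ; ∪-zeroˡ; ∈⊤; ∉⊥; ⊆⊤; ⊥⊆; _∈?_)
open import Data.Vec using ([]; _∷_)
open import Data.List using (List; []; _∷_; length; applyUpTo; allFin)
open import Data.List.Relation.Unary.All using (All; []; _∷_; tabulate) renaming (map to All-map)
open import Data.List.Relation.Unary.Any using (here; there)
open import Data.List.Membership.Propositional renaming (_∈_ to _∈ₗ_)
open import Data.List.Membership.Propositional.Properties using (∈-applyUpTo⁺; ∈-applyUpTo⁻; ∈-allFin)
open import Data.Product using (_×_; ∃-syntax; _,_; proj₁; proj₂)
open import Data.Sum using (_⊎_; inj₁; inj₂) renaming (map to ⊎-map)
open import Function using (_∘_; id)
open import Relation.Nullary using (¬_; yes; no; contradiction)
open import Relation.Unary using (Decidable)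
open import Relation.Binary.PropositionalEquality using (_≡_; refl; sym; trans; cong; cong₂; subst)

∣p∩q∣+∣p∪q∣≡∣p∣+∣q∣ : ∀ {k} (p q : Subset k) → ∣ p ∩ q ∣ + ∣ p ∪ q ∣ ≡ ∣ p ∣ + ∣ q ∣
∣p∩q∣+∣p∪q∣≡∣p∣+∣q∣ []            []            = refl
∣p∩q∣+∣p∪q∣≡∣p∣+∣q∣ (outside ∷ p) (outside ∷ q) = ∣p∩q∣+∣p∪q∣≡∣p∣+∣q∣ p q
∣p∩q∣+∣p∪q∣≡∣p∣+∣q∣ (inside  ∷ p) (outside ∷ q) =
  trans (+-suc _ _) (cong suc (∣p∩q∣+∣p∪q∣≡∣p∣+∣q∣ p q))
∣p∩q∣+∣p∪q∣≡∣p∣+∣q∣ (outside ∷ p) (inside  ∷ q) =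
  trans (+-suc _ _) (trans (cong suc (∣p∩q∣+∣p∪q∣≡∣p∣+∣q∣ p q)) (sym (+-suc _ _)))
∣p∩q∣+∣p∪q∣≡∣p∣+∣q∣ (inside  ∷ p) (inside  ∷ q) =
  cong suc (trans (+-suc _ _) (trans (cong suc (∣p∩q∣+∣p∪q∣≡∣p∣+∣q∣ p q)) (sym (+-suc _ _))))

drop-point : ∀ {P : ℕ → Set} → Decidable P → P 0 → ∀ k → ¬ P (suc k) →
             ∃[ i ] (i ≤ k × P i × ¬ P (suc i))
drop-point P? p₀ zero    ¬p₁ = 0 , z≤n , p₀ , ¬p₁
drop-point P? p₀ (suc k) ¬pₖ₊₂ with P? (suc k)
... | yes pₖ₊₁ = suc k , ≤-refl , pₖ₊₁ , ¬pₖ₊₂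
... | no ¬pₖ₊₁ with drop-point P? p₀ k ¬pₖ₊₁
...   | i , i≤k , pᵢ , ¬pᵢ₊₁ = i , m≤n⇒m≤1+n i≤k , pᵢ , ¬pᵢ₊₁

choose-witnesses : ∀ {A B : Set} {P : A → Set} {Q : B → Set} {R : A → B → Set} →
  Decidable P → (∀ {x} → P x → ∃[ y ] (Q y × R x y)) → (xs : List A) →
  ∃[ ys ] (All Q ys × (∀ {x} → x ∈ₗ xs → P x → ∃[ y ] (y ∈ₗ ys × R x y)))
choose-witnesses P? f [] = [] , [] , λ ()
choose-witnesses P? f (x ∷ xs) with choose-witnesses P? f xs | P? x
... | ys , qs , rs | no ¬px = ys , qs , λ where
  (here refl) px → contradiction px ¬px
  (there x∈)  px → rs x∈ px
... | ys , qs , rs | yes px with f px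
...   | y , qy , rxy = y ∷ ys , qy ∷ qs , λ where
  (here refl) _  → y , here refl , rxy
  (there x∈)  px′ → let y′ , y′∈ , r = rs x∈ px′ in y′ , there y′∈ , r

module _ {n : ℕ} where

  infixr 7 _∧ₛ_
  infixr 6 _∨ₛ_
  infix  4 _≤ₛ_

  top bot : Sep n
  top = ⊤ , ⊥
  bot = ⊥ , ⊤

  _∧ₛ_ _∨ₛ_ : Sep n → Sep n → Sep n
  (A , B) ∧ₛ (C , D) = A ∩ C , B ∪ D
  (A , B) ∨ₛ (C , D) = A ∪ C , B ∩ D

  _≤ₛ_ : Sep n → Sep n → Set
  (A , B) ≤ₛ (C , D) = A ⊆ C × D ⊆ B

  ≤ₛ-refl : ∀ {s} → s ≤ₛ s
  ≤ₛ-refl = id , id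

  ≤ₛ-trans : ∀ {s t u} → s ≤ₛ t → t ≤ₛ u → s ≤ₛ u
  ≤ₛ-trans (A⊆C , D⊆B) (C⊆E , F⊆D) = C⊆E ∘ A⊆C , D⊆B ∘ F⊆D

  ≤ₛ-top : ∀ {s} → s ≤ₛ top
  ≤ₛ-top = ⊆⊤ , ⊥⊆

  ∧ₛ-identityˡ : ∀ s → top ∧ₛ s ≡ s
  ∧ₛ-identityˡ (A , B) = cong₂ _,_ (∩-identityˡ A) (∪-identityˡ B)

  ∧ₛ-zeroˡ : ∀ s → bot ∧ₛ s ≡ bot
  ∧ₛ-zeroˡ (A , B) = cong₂ _,_ (∩-zeroˡ A) (∪-zeroˡ B)

  ∨ₛ-identityˡ : ∀ s → bot ∨ₛ s ≡ s
  ∨ₛ-identityˡ (A , B) = cong₂ _,_ (∪-identityˡ A) (∩-identityˡ B)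

  ∧ₛ-mono : ∀ {s s′ t t′} → s ≤ₛ s′ → t ≤ₛ t′ → s ∧ₛ t ≤ₛ s′ ∧ₛ t′
  ∧ₛ-mono {A , _} {_ , B′} {C , _} {_ , D′} (A⊆ , ⊆B) (C⊆ , ⊆D) =
    (λ v → let a , c = x∈p∩q⁻ A C v in x∈p∩q⁺ (A⊆ a , C⊆ c)) ,
    x∈p∪q⁺ ∘ ⊎-map ⊆B ⊆D ∘ x∈p∪q⁻ B′ D′

  ∨ₛ-mono : ∀ {s s′ t t′} → s ≤ₛ s′ → t ≤ₛ t′ → s ∨ₛ t ≤ₛ s′ ∨ₛ t′
  ∨ₛ-mono {A , _} {_ , B′} {C , _} {_ , D′} (A⊆ , ⊆B) (C⊆ , ⊆D) =
    x∈p∪q⁺ ∘ ⊎-map A⊆ C⊆ ∘ x∈p∪q⁻ A C ,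
    (λ v → let b , d = x∈p∩q⁻ B′ D′ v in x∈p∩q⁺ (⊆B b , ⊆D d))

  order-submodular : ∀ s t → order (s ∧ₛ t) + order (s ∨ₛ t) ≤ order s + order t
  order-submodular (A , B) (C , D) = begin
    ∣ S ∣ + ∣ T ∣          ≡⟨ sym (∣p∩q∣+∣p∪q∣≡∣p∣+∣q∣ S T) ⟩
    ∣ S ∩ T ∣ + ∣ S ∪ T ∣  ≤⟨ +-mono-≤ (p⊆q⇒∣p∣≤∣q∣ S∩T⊆P∩Q) (p⊆q⇒∣p∣≤∣q∣ S∪T⊆P∪Q) ⟩
    ∣ P ∩ Q ∣ + ∣ P ∪ Q ∣  ≡⟨ ∣p∩q∣+∣p∪q∣≡∣p∣+∣q∣ P Q ⟩
    ∣ P ∣ + ∣ Q ∣          ∎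
    where
    open ≤-Reasoning
    S T P Q : Subset n
    S = (A ∩ C) ∩ (B ∪ D)
    T = (A ∪ C) ∩ (B ∩ D)
    P = A ∩ B
    Q = C ∩ D

    S∩T⊆P∩Q : S ∩ T ⊆ P ∩ Q
    S∩T⊆P∩Q v∈S∩T =
      let v∈S , v∈T = x∈p∩q⁻ S T v∈S∩T
          a , c = x∈p∩q⁻ A C (proj₁ (x∈p∩q⁻ (A ∩ C) (B ∪ D) v∈S))
          b , d = x∈p∩q⁻ B D (proj₂ (x∈p∩q⁻ (A ∪ C) (B ∩ D) v∈T))
      in x∈p∩q⁺ (x∈p∩q⁺ (a , b) , x∈p∩q⁺ (c , d))

    S⊆P∪Q : S ⊆ P ∪ Q
    S⊆P∪Q v∈S with x∈p∩q⁻ (A ∩ C) (B ∪ D) v∈S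
    ... | a∩c , b∪d with x∈p∩q⁻ A C a∩c | x∈p∪q⁻ B D b∪d
    ...   | a , _ | inj₁ b = x∈p∪q⁺ (inj₁ (x∈p∩q⁺ (a , b)))
    ...   | _ , c | inj₂ d = x∈p∪q⁺ (inj₂ (x∈p∩q⁺ (c , d)))

    T⊆P∪Q : T ⊆ P ∪ Q
    T⊆P∪Q v∈T with x∈p∩q⁻ (A ∪ C) (B ∩ D) v∈T
    ... | a∪c , b∩d with x∈p∪q⁻ A C a∪c | x∈p∩q⁻ B D b∩d
    ...   | inj₁ a | b , _ = x∈p∪q⁺ (inj₁ (x∈p∩q⁺ (a , b)))
    ...   | inj₂ c | _ , d = x∈p∪q⁺ (inj₂ (x∈p∩q⁺ (c , d)))

    S∪T⊆P∪Q : S ∪ T ⊆ P ∪ Q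
    S∪T⊆P∪Q v with x∈p∪q⁻ S T v
    ... | inj₁ v∈S = S⊆P∪Q v∈S
    ... | inj₂ v∈T = T⊆P∪Q v∈T

  record IsSublattice (P : Sep n → Set) : Set where
    field
      ∧ₛ-closed : ∀ {s t} → P s → P t → P (s ∧ₛ t)
      ∨ₛ-closed : ∀ {s t} → P s → P t → P (s ∨ₛ t)
  open IsSublattice

  Covers : Sep n → Set
  Covers (A , B) = ∀ v → v ∈ A ⊎ v ∈ B

  covers-sublattice : IsSublattice Covers
  covers-sublattice .∧ₛ-closed {A , B} {C , D} s t v with s v | t v
  ... | inj₁ a | inj₁ c = inj₁ (x∈p∩q⁺ (a , c))
  ... | inj₂ b | _      = inj₂ (x∈p∪q⁺ (inj₁ b))
  ... | inj₁ _ | inj₂ d = inj₂ (x∈p∪q⁺ (inj₂ d))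
  covers-sublattice .∨ₛ-closed {A , B} {C , D} s t v with s v | t v
  ... | inj₂ b | inj₂ d = inj₂ (x∈p∩q⁺ (b , d))
  ... | inj₁ a | _      = inj₁ (x∈p∪q⁺ (inj₁ a))
  ... | inj₂ _ | inj₁ c = inj₁ (x∈p∪q⁺ (inj₂ c))

  -- The m-th elementary symmetric polynomial: the join, over all m-element
  -- sublists of L, of their meets (the empty meet is top, the empty join bot).
  elementary : List (Sep n) → ℕ → Sep n
  elementary L       zero    = top
  elementary []      (suc m) = bot
  elementary (s ∷ L) (suc m) = elementary L (suc m) ∨ₛ elementary L m ∧ₛ s

  elementary-beyond : ∀ L {m} → length L < m → elementary L m ≡ bot
  elementary-beyond []      {suc m} _ = refl
  elementary-beyond (s ∷ L) {suc m} (s≤s len<m) =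
    trans (cong₂ (λ b a → b ∨ₛ a ∧ₛ s) (elementary-beyond L (m≤n⇒m≤1+n len<m))
                                      (elementary-beyond L len<m))
          (trans (∨ₛ-identityˡ _) (∧ₛ-zeroˡ s))

  elementary-step : ∀ L m → elementary L (suc m) ≤ₛ elementary L m
  elementary-step L       zero    = ≤ₛ-top
  elementary-step []      (suc m) = ≤ₛ-refl
  elementary-step (s ∷ L) (suc m) =
    ∨ₛ-mono (elementary-step L (suc m)) (∧ₛ-mono (elementary-step L m) ≤ₛ-refl)

  elementary-antitone : ∀ L {i j} → i ≤ j → elementary L j ≤ₛ elementary L i
  elementary-antitone L = go ∘ ≤⇒≤′
    where
    go : ∀ {i j} → i ≤′ j → elementary L j ≤ₛ elementary L i
    go ≤′-refl        = ≤ₛ-refl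
    go (≤′-step i≤′j) = ≤ₛ-trans (elementary-step L _) (go i≤′j)

  elementary-nested : ∀ L i j → Nested (elementary L i) (elementary L j)
  elementary-nested L i j with ≤-total i j
  ... | inj₁ i≤j = inj₂ (elementary-antitone L i≤j)
  ... | inj₂ j≤i = inj₁ (elementary-antitone L j≤i)

  elementary-closed : ∀ {P} → IsSublattice P → P top → P bot →
                      ∀ {L} → All P L → ∀ m → P (elementary L m)
  elementary-closed P-lat p⊤ p⊥ _          zero    = p⊤
  elementary-closed P-lat p⊤ p⊥ []         (suc m) = p⊥
  elementary-closed P-lat p⊤ p⊥ (ps ∷ pL) (suc m) =
    P-lat .∨ₛ-closed (elementary-closed P-lat p⊤ p⊥ pL (suc m))
                     (P-lat .∧ₛ-closed (elementary-closed P-lat p⊤ p⊥ pL m) ps)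

  -- Here top and bot need not satisfy P: for 1 ≤ m ≤ length L they only enter
  -- as units, top ∧ₛ s = s and bot ∨ₛ x = x.
  elementary-closed-within : ∀ {P} → IsSublattice P → ∀ {L} → All P L →
                             ∀ {i} → i < length L → P (elementary L (suc i))
  elementary-closed-within {P} P-lat {s ∷ L} (ps ∷ pL) {i} (s≤s i≤len) =
    join-with-next i≤len (meet-with-previous i i≤len)
    where
    meet-with-previous : ∀ j → j ≤ length L → P (elementary L j ∧ₛ s)
    meet-with-previous zero    _     = subst P (sym (∧ₛ-identityˡ s)) ps
    meet-with-previous (suc j) j<len =
      P-lat .∧ₛ-closed (elementary-closed-within P-lat pL j<len) ps

    join-with-next : ∀ {x} → i ≤ length L → P x → P (elementary L (suc i) ∨ₛ x)
    join-with-next {x} i≤len px with m≤n⇒m<n∨m≡n i≤len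
    ... | inj₁ i<len = P-lat .∨ₛ-closed (elementary-closed-within P-lat pL i<len) px
    ... | inj₂ refl  =
      subst P (sym (trans (cong (_∨ₛ x) (elementary-beyond L ≤-refl)) (∨ₛ-identityˡ x))) px

  elementary-covers : ∀ {L} → All Covers L → ∀ m → Covers (elementary L m)
  elementary-covers = elementary-closed covers-sublattice (λ _ → inj₁ ∈⊤) (λ _ → inj₂ ∈⊤)

  ∈-separator-step : ∀ {a b s v} →
    v ∈ proj₁ b ⊎ v ∈ proj₁ a × v ∈ proj₁ s → v ∈ proj₂ b → v ∈ proj₂ a ⊎ v ∈ proj₂ s →
    v ∈ separator (b ∨ₛ a ∧ₛ s)
  ∈-separator-step v∈A v∈B v∈B′ =
    x∈p∩q⁺ ( x∈p∪q⁺ (⊎-map id x∈p∩q⁺ v∈A)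
           , x∈p∩q⁺ (v∈B , x∈p∪q⁺ v∈B′))

  elementary-separator : ∀ {L} → All Covers L → ∀ {s v} → s ∈ₗ L → v ∈ separator s →
                         ∃[ i ] (i < length L × v ∈ separator (elementary L (suc i)))
  elementary-separator {t ∷ L} (_ ∷ cL) {v = v} (here refl) v∈sep
    with x∈p∩q⁻ (proj₁ t) (proj₂ t) v∈sep
  ... | v∈Aₜ , v∈Bₜ
    with drop-point (λ m → v ∈? proj₁ (elementary L m)) ∈⊤ (length L)
                    (subst (λ e → ¬ v ∈ proj₁ e) (sym (elementary-beyond L ≤-refl)) ∉⊥)
  ... | i , i≤len , v∈Aᵢ , v∉Aᵢ₊₁ =
    i , s≤s i≤len , ∈-separator-step (inj₂ (v∈Aᵢ , v∈Aₜ)) v∈Bᵢ₊₁ (inj₂ v∈Bₜ)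
    where
    v∈Bᵢ₊₁ : v ∈ proj₂ (elementary L (suc i))
    v∈Bᵢ₊₁ with elementary-covers cL (suc i) v
    ... | inj₁ v∈Aᵢ₊₁ = contradiction v∈Aᵢ₊₁ v∉Aᵢ₊₁
    ... | inj₂ v∈Bᵢ₊₁ = v∈Bᵢ₊₁
  elementary-separator {t ∷ L} (cₜ ∷ cL) {v = v} (there s∈L) v∈sep
    with elementary-separator cL s∈L v∈sep
  ... | i , i<len , v∈sepᵢ₊₁ with x∈p∩q⁻ _ _ v∈sepᵢ₊₁ | cₜ v
  ... | v∈Aᵢ₊₁ , v∈Bᵢ₊₁ | inj₁ v∈Aₜ =
    suc i , s≤s i<len ,
    ∈-separator-step (inj₂ (v∈Aᵢ₊₁ , v∈Aₜ)) (proj₂ (elementary-step L (suc i)) v∈Bᵢ₊₁) (inj₁ v∈Bᵢ₊₁)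
  ... | v∈Aᵢ₊₁ , v∈Bᵢ₊₁ | inj₂ v∈Bₜ =
    i , m<n⇒m<1+n i<len , ∈-separator-step (inj₁ v∈Aᵢ₊₁) v∈Bᵢ₊₁ (inj₂ v∈Bₜ)

module _ {n : ℕ} (G : Graph n) (X Y : Subset n) where
  open IsSublattice

  separation-sublattice : IsSublattice (IsSeparation G)
  separation-sublattice .∧ₛ-closed {A , B} {C , D} (cₛ , eₛ) (cₜ , eₜ) =
    covers-sublattice .∧ₛ-closed {A , B} {C , D} cₛ cₜ , edges
    where
    edges : ∀ u v → Adj G u v → (u ∈ A ∩ C × v ∈ A ∩ C) ⊎ (u ∈ B ∪ D × v ∈ B ∪ D)
    edges u v uv with eₛ u v uv | eₜ u v uv
    ... | inj₁ (uA , vA) | inj₁ (uC , vC) = inj₁ (x∈p∩q⁺ (uA , uC) , x∈p∩q⁺ (vA , vC))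
    ... | inj₂ (uB , vB) | _              = inj₂ (x∈p∪q⁺ (inj₁ uB) , x∈p∪q⁺ (inj₁ vB))
    ... | inj₁ _         | inj₂ (uD , vD) = inj₂ (x∈p∪q⁺ (inj₂ uD) , x∈p∪q⁺ (inj₂ vD))
  separation-sublattice .∨ₛ-closed {A , B} {C , D} (cₛ , eₛ) (cₜ , eₜ) =
    covers-sublattice .∨ₛ-closed {A , B} {C , D} cₛ cₜ , edges
    where
    edges : ∀ u v → Adj G u v → (u ∈ A ∪ C × v ∈ A ∪ C) ⊎ (u ∈ B ∩ D × v ∈ B ∩ D)
    edges u v uv with eₛ u v uv | eₜ u v uv
    ... | inj₂ (uB , vB) | inj₂ (uD , vD) = inj₂ (x∈p∩q⁺ (uB , uD) , x∈p∩q⁺ (vB , vD))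
    ... | inj₁ (uA , vA) | _              = inj₁ (x∈p∪q⁺ (inj₁ uA) , x∈p∪q⁺ (inj₁ vA))
    ... | inj₂ _         | inj₁ (uC , vC) = inj₁ (x∈p∪q⁺ (inj₂ uC) , x∈p∪q⁺ (inj₂ vC))

  XY-separation-sublattice : IsSublattice (IsXYSep G X Y)
  XY-separation-sublattice .∧ₛ-closed (sepₛ , X⊆Aₛ , Y⊆Bₛ) (sepₜ , X⊆Aₜ , _) =
    separation-sublattice .∧ₛ-closed sepₛ sepₜ ,
    (λ x → x∈p∩q⁺ (X⊆Aₛ x , X⊆Aₜ x)) , x∈p∪q⁺ ∘ inj₁ ∘ Y⊆Bₛ
  XY-separation-sublattice .∨ₛ-closed (sepₛ , X⊆Aₛ , Y⊆Bₛ) (sepₜ , _ , Y⊆Bₜ) =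
    separation-sublattice .∨ₛ-closed sepₛ sepₜ ,
    x∈p∪q⁺ ∘ inj₁ ∘ X⊆Aₛ , (λ y → x∈p∩q⁺ (Y⊆Bₛ y , Y⊆Bₜ y))

  -- Submodularity, together with order t ≤ order (s ∨ₛ t) and order s ≤ order (s ∧ₛ t)
  -- by minimality.
  min-XY-separation-sublattice : IsSublattice (IsMinXYSep G X Y)
  min-XY-separation-sublattice .∧ₛ-closed {s} {t} (xyₛ , minₛ) (xyₜ , minₜ) =
    XY-separation-sublattice .∧ₛ-closed xyₛ xyₜ , λ u xyᵤ → ≤-trans meet≤s (minₛ u xyᵤ)
    where
    meet≤s : order (s ∧ₛ t) ≤ order s
    meet≤s = +-cancelʳ-≤ (order (s ∨ₛ t)) _ _
      (≤-trans (order-submodular s t)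
               (+-monoʳ-≤ (order s) (minₜ _ (XY-separation-sublattice .∨ₛ-closed xyₛ xyₜ))))
  min-XY-separation-sublattice .∨ₛ-closed {s} {t} (xyₛ , minₛ) (xyₜ , minₜ) =
    XY-separation-sublattice .∨ₛ-closed xyₛ xyₜ , λ u xyᵤ → ≤-trans join≤t (minₜ u xyᵤ)
    where
    join≤t : order (s ∨ₛ t) ≤ order t
    join≤t = +-cancelˡ-≤ (order (s ∧ₛ t)) _ _
      (≤-trans (order-submodular s t)
               (+-monoˡ-≤ (order t) (minₛ _ (XY-separation-sublattice .∧ₛ-closed xyₛ xyₜ))))

lemma3 : ∀ {n : ℕ} (G : Graph n) (X Y Z : Subset n) →
    (∀ {z} → z ∈ Z → ∃[ s ] (IsMinXYSep G X Y s × z ∈ separator s)) →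
    ∃[ 𝒮 ] (All (IsMinXYSep G X Y) 𝒮 × NestedSet 𝒮 × SeparatorsCover 𝒮 Z)
lemma3 {n} G X Y Z witness with choose-witnesses (_∈? Z) witness (allFin n)
... | L , L-minimal , L-witnesses = chain , chain-minimal , chain-nested , chain-covers
  where
  chain : List (Sep n)
  chain = applyUpTo (elementary L ∘ suc) (length L)

  chain-minimal : All (IsMinXYSep G X Y) chain
  chain-minimal = tabulate λ s∈ →
    let i , i<len , s≡ = ∈-applyUpTo⁻ (elementary L ∘ suc) s∈ in
    subst (IsMinXYSep G X Y) (sym s≡)
          (elementary-closed-within (min-XY-separation-sublattice G X Y) L-minimal i<len)

  chain-nested : NestedSet chain
  chain-nested s∈ t∈ with ∈-applyUpTo⁻ (elementary L ∘ suc) s∈ | ∈-applyUpTo⁻ (elementary L ∘ suc) t∈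
  ... | i , _ , refl | j , _ , refl = elementary-nested L (suc i) (suc j)

  L-covers : All Covers L
  L-covers = All-map (proj₁ ∘ proj₁ ∘ proj₁) L-minimal

  chain-covers : SeparatorsCover chain Z
  chain-covers {z} z∈Z =
    let s , s∈L , z∈sep = L-witnesses (∈-allFin z) z∈Z
        i , i<len , z∈sepᵢ = elementary-separator L-covers s∈L z∈sep
    in elementary L (suc i) , ∈-applyUpTo⁺ (elementary L ∘ suc) i<len , z∈sepᵢ
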